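{- Let $n$ be a positive integer such that $\sigma(n)=\sigma(n+1)$, where $\sigma(m)$ denotes the sum of the positive divisors of $m$. Then $\sigma(n)$ is divisible by $2$ or by $3$.
   Context: $\sigma(m)=\sum_{d\mid m,\ d>0} d$ is the sum of the positive divisors of $m$. -}

module Defs where

open import Data.Nat using (ℕ; zero; suc; _+_)
open import Data.Nat.Divisibility using (_∣?_)
open import Relation.Nullary.Decidable using (yes; no)

σ' : ℕ → ℕ → ℕ
σ' m zero = 0
σ' m (suc k) with suc k ∣? m
... | yes _ = suc k + σ' m k
... | no  _ = σ' m k

-- σ m = sum of the positive divisors of m (every positive divisor of m ≥ 1 is ≤ m)
σ : ℕ → ℕ
σ m = σ' m m

module Submission where

-- (1) For odd m the divisors pair up as d ↔ m/d, and a pair with d ≠ m/d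
--     contributes the even number d + m/d; so if σ(m) is odd, m is a square.
-- (2) Writing M = 2^k·o with o odd, σ(M) = (2^(k+1) − 1)·σ(o).
-- (3) If σ(M) is divisible by neither 2 nor 3, then σ(o) is odd, so o is a
--     square by (1), and k is even because 3 ∣ 2^(k+1) − 1 for odd k; hence M
--     itself is a square.
-- (4) If σ(n) = σ(n+1) were prime to 6, both n and n+1 would be positive
--     squares by (3), which is impossible.

open import Defs
open import Data.Nat using (ℕ; _+_; _≤_)
open import Data.Nat.Divisibility using (_∣_)
open import Data.Sum using (_⊎_)
open import Relation.Binary.PropositionalEquality using (_≡_)

open import Data.Empty using (⊥; ⊥-elim)
open import Data.Nat using (zero; suc; _*_; _∸_; _^_; _<_; z≤n; s≤s; _≟_; _<?_; _≤?_; >-nonZero)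
open import Data.Nat.Divisibility
  using (divides; _∣?_; _∣0; ∣-refl; ∣-trans; m∣m*n; ∣m∣n⇒∣m+n; ∣m⇒∣m*n; ∣n⇒∣m*n; *-monoʳ-∣; *-cancelˡ-∣; ∣⇒≤)
open import Data.Nat.Induction using (<-wellFounded)
open import Data.Nat.Primality using (euclidsLemma; prime[2])
open import Data.Nat.Properties
open import Algebra.Properties.CommutativeSemigroup +-commutativeSemigroup
  using (interchange; xy∙z≈xz∙y)
open import Data.Nat.Tactic.RingSolver using (solve-∀)
open import Data.Product using (Σ; ∃; _×_; _,_; proj₁)
open import Data.Sum using (inj₁; inj₂)
open import Function using (_∘_)
open import Induction.WellFounded using (Acc; acc)
open import Relation.Binary using (tri<; tri≈; tri>)
open import Relation.Binary.PropositionalEquality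
  using (_≢_; refl; sym; trans; cong; cong₂; subst; module ≡-Reasoning)
open import Relation.Nullary using (Dec; yes; no; ¬_)

parity : ∀ k → (∃ λ j → k ≡ 2 * j) ⊎ (∃ λ j → k ≡ suc (2 * j))
parity zero = inj₁ (0 , refl)
parity (suc k) with parity k
... | inj₁ (j , refl) = inj₂ (j , refl)
... | inj₂ (j , refl) = inj₁ (suc j , sym (*-suc 2 j))

odd⇒2h+1 : ∀ {a} → ¬ 2 ∣ a → ∃ λ h → a ≡ suc (2 * h)
odd⇒2h+1 {a} odd-a with parity a
... | inj₁ (h , a≡2h) = ⊥-elim (odd-a (divides h (trans a≡2h (*-comm 2 h))))
... | inj₂ r = r

2h+1-odd : ∀ h → ¬ 2 ∣ suc (2 * h)
2h+1-odd h (divides k eq) = even≢odd k h (sym (trans eq (*-comm k 2)))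

odd+odd : ∀ {a b} → ¬ 2 ∣ a → ¬ 2 ∣ b → 2 ∣ a + b
odd+odd odd-a odd-b with odd⇒2h+1 odd-a | odd⇒2h+1 odd-b
... | h , refl | h′ , refl = divides (suc (h + h′)) (sum-of-odds h h′)
  where
  sum-of-odds : ∀ h h′ → suc (2 * h) + suc (2 * h′) ≡ suc (h + h′) * 2
  sum-of-odds = solve-∀

odd⇒pos : ∀ {o} → ¬ 2 ∣ o → 1 ≤ o
odd⇒pos odd-o = n≢0⇒n>0 (λ o≡0 → odd-o (subst (2 ∣_) (sym o≡0) (2 ∣0)))

factor-pos : ∀ {m} q d → m ≡ q * d → 1 ≤ m → 1 ≤ q
factor-pos zero    d refl ()
factor-pos (suc q) d _    _ = s≤s z≤n

-- Finite sums

∑ : ℕ → (ℕ → ℕ) → ℕ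
∑ zero    f = 0
∑ (suc N) f = f (suc N) + ∑ N f

∑-cong : ∀ N {f g : ℕ → ℕ} → (∀ i → 1 ≤ i → i ≤ N → f i ≡ g i) → ∑ N f ≡ ∑ N g
∑-cong zero    eq = refl
∑-cong (suc N) eq =
  cong₂ _+_ (eq (suc N) (s≤s z≤n) ≤-refl) (∑-cong N (λ i 1≤i i≤N → eq i 1≤i (m≤n⇒m≤1+n i≤N)))

∑-cong′ : ∀ N {f g : ℕ → ℕ} → (∀ i → f i ≡ g i) → ∑ N f ≡ ∑ N g
∑-cong′ N eq = ∑-cong N (λ i _ _ → eq i)

∑-vanish : ∀ N {f : ℕ → ℕ} → (∀ i → 1 ≤ i → i ≤ N → f i ≡ 0) → ∑ N f ≡ 0
∑-vanish zero    vanish = refl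
∑-vanish (suc N) vanish =
  cong₂ _+_ (vanish (suc N) (s≤s z≤n) ≤-refl) (∑-vanish N (λ i 1≤i i≤N → vanish i 1≤i (m≤n⇒m≤1+n i≤N)))

∑-+ : ∀ N (f g : ℕ → ℕ) → ∑ N (λ i → f i + g i) ≡ ∑ N f + ∑ N g
∑-+ zero    f g = refl
∑-+ (suc N) f g =
  trans (cong (f (suc N) + g (suc N) +_) (∑-+ N f g)) (interchange (f (suc N)) (g (suc N)) (∑ N f) (∑ N g))

∑-*ˡ : ∀ c N (f : ℕ → ℕ) → ∑ N (λ i → c * f i) ≡ c * ∑ N f
∑-*ˡ c zero    f = sym (*-zeroʳ c)
∑-*ˡ c (suc N) f =
  trans (cong (c * f (suc N) +_) (∑-*ˡ c N f)) (sym (*-distribˡ-+ c (f (suc N)) (∑ N f)))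

∑-swap : ∀ M N (g : ℕ → ℕ → ℕ) → ∑ M (λ d → ∑ N (g d)) ≡ ∑ N (λ e → ∑ M (λ d → g d e))
∑-swap zero    N g = sym (∑-vanish N (λ _ _ _ → refl))
∑-swap (suc M) N g =
  trans (cong (∑ N (g (suc M)) +_) (∑-swap M N g)) (sym (∑-+ N (g (suc M)) (λ e → ∑ M (λ d → g d e))))

∑-single : ∀ N {f : ℕ → ℕ} q → 1 ≤ q → q ≤ N →
           (∀ i → 1 ≤ i → i ≤ N → i ≢ q → f i ≡ 0) → ∑ N f ≡ f q
∑-single zero        q 1≤q q≤0 _ = ⊥-elim (<⇒≱ 1≤q q≤0)
∑-single (suc N) {f} q 1≤q q≤1+N others with suc N ≟ q
... | yes refl = trans (cong (f (suc N) +_) (∑-vanish N rest)) (+-identityʳ (f (suc N)))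
  where
  rest : ∀ i → 1 ≤ i → i ≤ N → f i ≡ 0
  rest i 1≤i i≤N = others i 1≤i (m≤n⇒m≤1+n i≤N) (<⇒≢ (s≤s i≤N))
... | no 1+N≢q = trans (cong (_+ ∑ N f) (others (suc N) (s≤s z≤n) ≤-refl 1+N≢q))
                       (∑-single N q 1≤q q≤N (λ i 1≤i i≤N → others i 1≤i (m≤n⇒m≤1+n i≤N)))
  where
  q≤N : q ≤ N
  q≤N = ≤-pred (≤∧≢⇒< q≤1+N (1+N≢q ∘ sym))

∑-nonzero : ∀ N (f : ℕ → ℕ) → ∑ N f ≢ 0 → ∃ λ i → f i ≢ 0
∑-nonzero zero    f ∑≢0 = ⊥-elim (∑≢0 refl)
∑-nonzero (suc N) f ∑≢0 with f (suc N) ≟ 0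
... | no  fN≢0 = suc N , fN≢0
... | yes fN≡0 = ∑-nonzero N f (∑≢0 ∘ trans (cong (_+ ∑ N f) fN≡0))

∑-∣ : ∀ {c} N (f : ℕ → ℕ) → (∀ i → c ∣ f i) → c ∣ ∑ N f
∑-∣ {c} zero    f c∣f = c ∣0
∑-∣     (suc N) f c∣f = ∣m∣n⇒∣m+n (c∣f (suc N)) (∑-∣ N f c∣f)

∑-extend : ∀ k N (f : ℕ → ℕ) → (∀ i → N < i → f i ≡ 0) → ∑ (k + N) f ≡ ∑ N f
∑-extend zero    N f vanish = refl
∑-extend (suc k) N f vanish =
  trans (cong (_+ ∑ (k + N) f) (vanish (suc (k + N)) (s≤s (m≤n+m N k)))) (∑-extend k N f vanish)

∑-double-trim : ∀ x (f : ℕ → ℕ) → (∀ i → x < i → f i ≡ 0) → ∑ (2 * x) f ≡ ∑ x f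
∑-double-trim x f vanish = trans (cong (λ N → ∑ (x + N) f) (+-identityʳ x)) (∑-extend x x f vanish)

∑-evenOdd : ∀ x (f : ℕ → ℕ) → ∑ (2 * x) f ≡ ∑ x (λ j → f (2 * j)) + ∑ x (λ j → f (2 * j ∸ 1))
∑-evenOdd zero    f = refl
∑-evenOdd (suc x) f = begin
  ∑ (2 * suc x) f
    ≡⟨ cong (λ N → ∑ N f) (*-suc 2 x) ⟩
  f (2 + 2 * x) + (f (1 + 2 * x) + ∑ (2 * x) f)
    ≡⟨ cong (λ s → f (2 + 2 * x) + (f (1 + 2 * x) + s)) (∑-evenOdd x f) ⟩
  f (2 + 2 * x) + (f (1 + 2 * x) + (Even + Odd))
    ≡⟨ sym (+-assoc (f (2 + 2 * x)) (f (1 + 2 * x)) (Even + Odd)) ⟩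
  (f (2 + 2 * x) + f (1 + 2 * x)) + (Even + Odd)
    ≡⟨ interchange (f (2 + 2 * x)) (f (1 + 2 * x)) Even Odd ⟩
  (f (2 + 2 * x) + Even) + (f (1 + 2 * x) + Odd)
    ≡⟨ cong₂ (λ e o → (f e + Even) + (f (o ∸ 1) + Odd)) (sym (*-suc 2 x)) (sym (*-suc 2 x)) ⟩
  ∑ (suc x) (λ j → f (2 * j)) + ∑ (suc x) (λ j → f (2 * j ∸ 1)) ∎
  where
  open ≡-Reasoning
  Even Odd : ℕ
  Even = ∑ x (λ j → f (2 * j))
  Odd  = ∑ x (λ j → f (2 * j ∸ 1))

∑∑ : ℕ → (ℕ → ℕ → ℕ) → ℕ
∑∑ N f = ∑ N (λ d → ∑ N (f d))

∑∑-cong : ∀ N {f g : ℕ → ℕ → ℕ} → (∀ d e → f d e ≡ g d e) → ∑∑ N f ≡ ∑∑ N g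
∑∑-cong N eq = ∑-cong′ N (λ d → ∑-cong′ N (eq d))

∑∑-+ : ∀ N (f g : ℕ → ℕ → ℕ) → ∑∑ N (λ d e → f d e + g d e) ≡ ∑∑ N f + ∑∑ N g
∑∑-+ N f g = trans (∑-cong′ N (λ d → ∑-+ N (f d) (g d))) (∑-+ N _ _)

when : ∀ {p} {P : Set p} → Dec P → ℕ → ℕ
when (yes _) x = x
when (no  _) _ = 0

when-yes : ∀ {p} {P : Set p} (dp : Dec P) {x} → P → when dp x ≡ x
when-yes (yes _) _  = refl
when-yes (no ¬p) p = ⊥-elim (¬p p)

when-no : ∀ {p} {P : Set p} (dp : Dec P) {x} → ¬ P → when dp x ≡ 0
when-no (yes p) ¬p = ⊥-elim (¬p p)
when-no (no _)  _  = refl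

when-+ : ∀ {p} {P : Set p} (dp : Dec P) {x y} → when dp (x + y) ≡ when dp x + when dp y
when-+ (yes _) = refl
when-+ (no _)  = refl

when-∣ : ∀ {p} {P : Set p} (dp : Dec P) {c x} → c ∣ x → c ∣ when dp x
when-∣ (yes _) c∣x = c∣x
when-∣ (no _)  _   = _ ∣0

trichotomy-split : ∀ d e x → x ≡ when (d <? e) x + when (d ≟ e) x + when (e <? d) x
trichotomy-split d e x with <-cmp d e
... | tri< d<e d≢e d≯e
  rewrite when-yes (d <? e) {x} d<e | when-no (d ≟ e) {x} d≢e | when-no (e <? d) {x} d≯e =
  sym (trans (+-identityʳ (x + 0)) (+-identityʳ x))
... | tri≈ d≮e d≡e d≯e
  rewrite when-no (d <? e) {x} d≮e | when-yes (d ≟ e) {x} d≡e | when-no (e <? d) {x} d≯e =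
  sym (+-identityʳ x)
... | tri> d≮e d≢e e<d
  rewrite when-no (d <? e) {x} d≮e | when-no (d ≟ e) {x} d≢e | when-yes (e <? d) {x} e<d =
  refl

∑∑-symmetrise : ∀ N (f : ℕ → ℕ → ℕ) →
  ∑∑ N f ≡ ∑∑ N (λ d e → when (d <? e) (f d e + f e d)) + ∑∑ N (λ d e → when (d ≟ e) (f d e))
∑∑-symmetrise N f = begin
  ∑∑ N f
    ≡⟨ ∑∑-cong N (λ d e → trichotomy-split d e (f d e)) ⟩
  ∑∑ N (λ d e → lower d e + diag d e + upper d e)
    ≡⟨ ∑∑-+ N _ upper ⟩
  ∑∑ N (λ d e → lower d e + diag d e) + ∑∑ N upper
    ≡⟨ cong (_+ ∑∑ N upper) (∑∑-+ N lower diag) ⟩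
  ∑∑ N lower + ∑∑ N diag + ∑∑ N upper
    ≡⟨ xy∙z≈xz∙y (∑∑ N lower) (∑∑ N diag) (∑∑ N upper) ⟩
  ∑∑ N lower + ∑∑ N upper + ∑∑ N diag
    ≡⟨ cong (λ s → ∑∑ N lower + s + ∑∑ N diag) (∑-swap N N upper) ⟩
  ∑∑ N lower + ∑∑ N (λ d e → upper e d) + ∑∑ N diag
    ≡⟨ cong (_+ ∑∑ N diag) (sym (∑∑-+ N lower (λ d e → upper e d))) ⟩
  ∑∑ N (λ d e → lower d e + upper e d) + ∑∑ N diag
    ≡⟨ cong (_+ ∑∑ N diag) (∑∑-cong N (λ d e → sym (when-+ (d <? e)))) ⟩
  ∑∑ N (λ d e → when (d <? e) (f d e + f e d)) + ∑∑ N diag ∎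
  where
  open ≡-Reasoning
  lower diag upper : ℕ → ℕ → ℕ
  lower d e = when (d <? e) (f d e)
  diag  d e = when (d ≟ e) (f d e)
  upper d e = when (e <? d) (f d e)

divisorTerm : ℕ → ℕ → ℕ
divisorTerm m d = when (d ∣? m) d

σ'≡∑ : ∀ m k → σ' m k ≡ ∑ k (divisorTerm m)
σ'≡∑ m zero = refl
σ'≡∑ m (suc k) with suc k ∣? m
... | yes _ = cong (suc k +_) (σ'≡∑ m k)
... | no  _ = σ'≡∑ m k

σ≡∑ : ∀ m → σ m ≡ ∑ m (divisorTerm m)
σ≡∑ m = σ'≡∑ m m

divisorTerm-large : ∀ {m} d → 1 ≤ m → m < d → divisorTerm m d ≡ 0
divisorTerm-large {m} d 1≤m m<d = when-no (d ∣? m) (λ d∣m → <⇒≱ m<d (∣⇒≤ {{>-nonZero 1≤m}} d∣m))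

-- (1) An odd number with odd divisor sum is a square

factorTerm : ℕ → ℕ → ℕ → ℕ
factorTerm m d e = when (d * e ≟ m) d

-- A divisor d of a positive m has exactly one cofactor e ∈ [1, m].
divisorTerm≡∑cofactors : ∀ {m} → 1 ≤ m → ∀ d → divisorTerm m d ≡ ∑ m (factorTerm m d)
divisorTerm≡∑cofactors {m} 1≤m d with d ∣? m
... | no d∤m =
  sym (∑-vanish m (λ e _ _ → when-no (d * e ≟ m) (λ de≡m → d∤m (divides e (trans (sym de≡m) (*-comm d e))))))
... | yes (divides q m≡qd) =
  sym (trans (∑-single m q 1≤q q≤m others) (when-yes (d * q ≟ m) (trans (*-comm d q) (sym m≡qd))))
  where
  1≤q : 1 ≤ q
  1≤q = factor-pos q d m≡qd 1≤m
  1≤d : 1 ≤ d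
  1≤d = factor-pos d q (trans m≡qd (*-comm q d)) 1≤m
  q≤m : q ≤ m
  q≤m = subst (q ≤_) (sym m≡qd) (m≤m*n q d {{>-nonZero 1≤d}})
  others : ∀ e → 1 ≤ e → e ≤ m → e ≢ q → factorTerm m d e ≡ 0
  others e _ _ e≢q = when-no (d * e ≟ m)
    (λ de≡m → e≢q (*-cancelˡ-≡ e q d {{>-nonZero 1≤d}} (trans de≡m (trans m≡qd (*-comm q d)))))

σ≡∑∑ : ∀ {m} → 1 ≤ m → σ m ≡ ∑∑ m (factorTerm m)
σ≡∑∑ {m} 1≤m = trans (σ≡∑ m) (∑-cong′ m (divisorTerm≡∑cofactors 1≤m))

factorTerm-pair-even : ∀ {m} → ¬ 2 ∣ m → ∀ d e → 2 ∣ factorTerm m d e + factorTerm m e d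
factorTerm-pair-even {m} odd-m d e with d * e ≟ m | e * d ≟ m
... | no _     | no _    = 2 ∣0
... | yes de≡m | no ed≢m = ⊥-elim (ed≢m (trans (*-comm e d) de≡m))
... | no de≢m  | yes ed≡m = ⊥-elim (de≢m (trans (*-comm d e) ed≡m))
... | yes de≡m | yes _   = odd+odd odd-d odd-e
  where
  odd-d : ¬ 2 ∣ d
  odd-d 2∣d = odd-m (subst (2 ∣_) de≡m (∣m⇒∣m*n e 2∣d))
  odd-e : ¬ 2 ∣ e
  odd-e 2∣e = odd-m (subst (2 ∣_) de≡m (∣n⇒∣m*n d 2∣e))

diagonal-square : ∀ {m} d e → when (d ≟ e) (factorTerm m d e) ≢ 0 → d * d ≡ m
diagonal-square {m} d e nonzero with d ≟ e
... | no _ = ⊥-elim (nonzero refl)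
... | yes refl with d * d ≟ m
...   | yes dd≡m = dd≡m
...   | no _     = ⊥-elim (nonzero refl)

-- Pairing d·e with e·d: σ m ≡ (even) + (diagonal terms d·d = m).
oddσ⇒square : ∀ {m} → 1 ≤ m → ¬ 2 ∣ m → ¬ 2 ∣ σ m → ∃ λ s → s * s ≡ m
oddσ⇒square {m} 1≤m odd-m odd-σ = square-on-diagonal (∑-nonzero m _ diagonal≢0)
  where
  pairs diagonal : ℕ
  pairs    = ∑∑ m (λ d e → when (d <? e) (factorTerm m d e + factorTerm m e d))
  diagonal = ∑∑ m (λ d e → when (d ≟ e) (factorTerm m d e))
  pairs-even : 2 ∣ pairs
  pairs-even = ∑-∣ m _ (λ d → ∑-∣ m _ (λ e → when-∣ (d <? e) (factorTerm-pair-even odd-m d e)))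
  diagonal≢0 : diagonal ≢ 0
  diagonal≢0 diagonal≡0 = odd-σ (subst (2 ∣_) (sym σ≡pairs) pairs-even)
    where
    σ≡pairs : σ m ≡ pairs
    σ≡pairs = trans (σ≡∑∑ 1≤m) (trans (∑∑-symmetrise m (factorTerm m))
                (trans (cong (pairs +_) diagonal≡0) (+-identityʳ pairs)))
  square-on-diagonal : (∃ λ d → ∑ m (λ e → when (d ≟ e) (factorTerm m d e)) ≢ 0) → ∃ λ s → s * s ≡ m
  square-on-diagonal (d , row≢0) with ∑-nonzero m _ row≢0
  ... | e , term≢0 = d , diagonal-square d e term≢0

-- (2) The divisor sum of 2^k·o for odd o

odd∣2x⇒∣x : ∀ {d x} → ¬ 2 ∣ d → d ∣ 2 * x → d ∣ x
odd∣2x⇒∣x {d} {x} odd-d (divides q 2x≡qd)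
  with euclidsLemma q d prime[2] (divides x (trans (sym 2x≡qd) (*-comm 2 x)))
... | inj₂ 2∣d = ⊥-elim (odd-d 2∣d)
... | inj₁ (divides h q≡2h) = divides h (*-cancelˡ-≡ x (h * d) 2 (begin
  2 * x       ≡⟨ 2x≡qd ⟩
  q * d       ≡⟨ cong (_* d) (trans q≡2h (*-comm h 2)) ⟩
  2 * h * d   ≡⟨ *-assoc 2 h d ⟩
  2 * (h * d) ∎))
  where open ≡-Reasoning

divisorTerm-double-even : ∀ x j → divisorTerm (2 * x) (2 * j) ≡ 2 * divisorTerm x j
divisorTerm-double-even x j with j ∣? x
... | yes j∣x = when-yes ((2 * j) ∣? (2 * x)) (*-monoʳ-∣ 2 j∣x)
... | no  j∤x = when-no ((2 * j) ∣? (2 * x)) (j∤x ∘ *-cancelˡ-∣ 2)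

divisorTerm-double-odd : ∀ x {d} → ¬ 2 ∣ d → divisorTerm (2 * x) d ≡ divisorTerm x d
divisorTerm-double-odd x {d} odd-d with d ∣? x
... | yes d∣x = when-yes (d ∣? (2 * x)) (∣n⇒∣m*n 2 d∣x)
... | no  d∤x = when-no (d ∣? (2 * x)) (d∤x ∘ odd∣2x⇒∣x odd-d)

2j∸1≡2[j-1]+1 : ∀ j → 2 * suc j ∸ 1 ≡ suc (2 * j)
2j∸1≡2[j-1]+1 j = cong (_∸ 1) (*-suc 2 j)

2j∸1-odd : ∀ j → 1 ≤ j → ¬ 2 ∣ 2 * j ∸ 1
2j∸1-odd (suc j) _ = subst (λ n → ¬ 2 ∣ n) (sym (2j∸1≡2[j-1]+1 j)) (2h+1-odd j)

oddDivisorSum : ℕ → ℕ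
oddDivisorSum x = ∑ x (λ j → divisorTerm x (2 * j ∸ 1))

-- Even divisors of 2x are the doubles of divisors of x; odd ones are unchanged.
σ-double : ∀ x → σ (2 * x) ≡ 2 * σ x + oddDivisorSum x
σ-double x = begin
  σ (2 * x)
    ≡⟨ σ≡∑ (2 * x) ⟩
  ∑ (2 * x) (divisorTerm (2 * x))
    ≡⟨ ∑-evenOdd x (divisorTerm (2 * x)) ⟩
  ∑ x (λ j → divisorTerm (2 * x) (2 * j)) + ∑ x (λ j → divisorTerm (2 * x) (2 * j ∸ 1))
    ≡⟨ cong₂ _+_ (∑-cong′ x (divisorTerm-double-even x))
                 (∑-cong x (λ j 1≤j _ → divisorTerm-double-odd x (2j∸1-odd j 1≤j))) ⟩
  ∑ x (λ j → 2 * divisorTerm x j) + oddDivisorSum x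
    ≡⟨ cong (_+ oddDivisorSum x) (∑-*ˡ 2 x (divisorTerm x)) ⟩
  2 * ∑ x (divisorTerm x) + oddDivisorSum x
    ≡⟨ cong (λ s → 2 * s + oddDivisorSum x) (sym (σ≡∑ x)) ⟩
  2 * σ x + oddDivisorSum x ∎
  where open ≡-Reasoning

oddDivisorSum-double : ∀ {x} → 1 ≤ x → oddDivisorSum (2 * x) ≡ oddDivisorSum x
oddDivisorSum-double {x} 1≤x =
  trans (∑-cong (2 * x) (λ j 1≤j _ → divisorTerm-double-odd x (2j∸1-odd j 1≤j)))
        (∑-double-trim x _ vanish)
  where
  vanish : ∀ j → x < j → divisorTerm x (2 * j ∸ 1) ≡ 0
  vanish (suc j) x<j = divisorTerm-large (2 * suc j ∸ 1) 1≤x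
    (≤-trans x<j (subst (suc j ≤_) (sym (2j∸1≡2[j-1]+1 j)) (s≤s (m≤n*m j 2))))

-- For odd o every divisor is odd.
oddDivisorSum-odd : ∀ {o} → ¬ 2 ∣ o → oddDivisorSum o ≡ σ o
oddDivisorSum-odd {o} odd-o = sym (begin
  σ o                                                     ≡⟨ σ≡∑ o ⟩
  ∑ o (divisorTerm o)                                     ≡⟨ sym (∑-double-trim o _ beyond-o) ⟩
  ∑ (2 * o) (divisorTerm o)                               ≡⟨ ∑-evenOdd o (divisorTerm o) ⟩
  ∑ o (λ j → divisorTerm o (2 * j)) + oddDivisorSum o     ≡⟨ cong (_+ oddDivisorSum o) (∑-vanish o even-terms) ⟩
  oddDivisorSum o                                         ∎)
  where
  open ≡-Reasoning
  beyond-o : ∀ d → o < d → divisorTerm o d ≡ 0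
  beyond-o d = divisorTerm-large d (odd⇒pos odd-o)
  even-terms : ∀ j → 1 ≤ j → j ≤ o → divisorTerm o (2 * j) ≡ 0
  even-terms j _ _ = when-no ((2 * j) ∣? o) (λ 2j∣o → odd-o (∣-trans (m∣m*n j) 2j∣o))

-- mersenne k = 1 + 2 + … + 2^k = 2^(k+1) − 1.
mersenne : ℕ → ℕ
mersenne zero    = 1
mersenne (suc k) = 2 * mersenne k + 1

-- σ(2^k·o) = (2^(k+1) − 1)·σ(o); the induction also tracks that the odd
-- divisors of 2^k·o are exactly those of o.
σ-2^k·odd : ∀ {o} → ¬ 2 ∣ o → ∀ k →
            σ (2 ^ k * o) ≡ mersenne k * σ o × oddDivisorSum (2 ^ k * o) ≡ σ o
σ-2^k·odd {o} odd-o zero =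
  trans (cong σ (*-identityˡ o)) (sym (*-identityˡ (σ o))) ,
  trans (cong oddDivisorSum (*-identityˡ o)) (oddDivisorSum-odd odd-o)
σ-2^k·odd {o} odd-o (suc k) with σ-2^k·odd odd-o k
... | σx≡ , oddx≡ = σ-step , trans (cong oddDivisorSum split) (trans (oddDivisorSum-double 1≤x) oddx≡)
  where
  open ≡-Reasoning
  x : ℕ
  x = 2 ^ k * o
  split : 2 ^ suc k * o ≡ 2 * x
  split = *-assoc 2 (2 ^ k) o
  1≤x : 1 ≤ x
  1≤x = *-mono-≤ (m^n>0 2 k) (odd⇒pos odd-o)
  σ-step : σ (2 ^ suc k * o) ≡ mersenne (suc k) * σ o
  σ-step = begin
    σ (2 ^ suc k * o)                  ≡⟨ cong σ split ⟩
    σ (2 * x)                          ≡⟨ σ-double x ⟩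
    2 * σ x + oddDivisorSum x          ≡⟨ cong₂ (λ a b → 2 * a + b) σx≡ oddx≡ ⟩
    2 * (mersenne k * σ o) + σ o       ≡⟨ sym (cong₂ _+_ (*-assoc 2 (mersenne k) (σ o)) (*-identityˡ (σ o))) ⟩
    2 * mersenne k * σ o + 1 * σ o     ≡⟨ sym (*-distribʳ-+ (σ o) (2 * mersenne k) 1) ⟩
    mersenne (suc k) * σ o             ∎

-- 3 ∣ 2^(k+1) − 1 whenever k is odd, since 4 ≡ 1 (mod 3).
3∣mersenne-odd : ∀ j → 3 ∣ mersenne (suc (2 * j))
3∣mersenne-odd zero    = divides 1 refl
3∣mersenne-odd (suc j) =
  subst (λ k → 3 ∣ mersenne (suc k)) (sym (*-suc 2 j))
    (subst (3 ∣_) (sym (mersenne-+2 (mersenne (suc (2 * j)))))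
           (∣m∣n⇒∣m+n (∣n⇒∣m*n 4 (3∣mersenne-odd j)) ∣-refl))
  where
  mersenne-+2 : ∀ a → 2 * (2 * a + 1) + 1 ≡ 4 * a + 3
  mersenne-+2 = solve-∀

2-adic : ∀ M → 1 ≤ M → Σ ℕ λ k → Σ ℕ λ o → ¬ 2 ∣ o × M ≡ 2 ^ k * o
2-adic M = go M (<-wellFounded M)
  where
  go : ∀ M → Acc _<_ M → 1 ≤ M → Σ ℕ λ k → Σ ℕ λ o → ¬ 2 ∣ o × M ≡ 2 ^ k * o
  go M (acc smaller) 1≤M with 2 ∣? M
  ... | no odd-M = 0 , M , odd-M , sym (*-identityˡ M)
  ... | yes (divides h M≡h2) = double (go h (smaller h<M) 1≤h)
    where
    1≤h : 1 ≤ h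
    1≤h = factor-pos h 2 M≡h2 1≤M
    h<M : h < M
    h<M = subst (h <_) (sym M≡h2) (m<m*n h 2 {{>-nonZero 1≤h}} (s≤s (s≤s z≤n)))
    double : (Σ ℕ λ k → Σ ℕ λ o → ¬ 2 ∣ o × h ≡ 2 ^ k * o) → Σ ℕ λ k → Σ ℕ λ o → ¬ 2 ∣ o × M ≡ 2 ^ k * o
    double (k , o , odd-o , h≡) =
      suc k , o , odd-o ,
      trans M≡h2 (trans (*-comm h 2) (trans (cong (2 *_) h≡) (sym (*-assoc 2 (2 ^ k) o))))

-- (3) and (4)

even-power-square : ∀ j s → 2 ^ (2 * j) * (s * s) ≡ (2 ^ j * s) * (2 ^ j * s)
even-power-square j s = begin
  2 ^ (2 * j) * (s * s)       ≡⟨ cong (λ e → 2 ^ (j + e) * (s * s)) (+-identityʳ j) ⟩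
  2 ^ (j + j) * (s * s)       ≡⟨ cong (_* (s * s)) (^-distribˡ-+-* 2 j j) ⟩
  (2 ^ j * 2 ^ j) * (s * s)   ≡⟨ regroup (2 ^ j) s ⟩
  (2 ^ j * s) * (2 ^ j * s)   ∎
  where
  open ≡-Reasoning
  regroup : ∀ p s → (p * p) * (s * s) ≡ (p * s) * (p * s)
  regroup = solve-∀

σ-prime-to-6⇒square : ∀ {M} → 1 ≤ M → ¬ 2 ∣ σ M → ¬ 3 ∣ σ M → ∃ λ s → s * s ≡ M
σ-prime-to-6⇒square {M} 1≤M 2∤σM 3∤σM = from-2-adic (2-adic M 1≤M)
  where
  from-2-adic : (Σ ℕ λ k → Σ ℕ λ o → ¬ 2 ∣ o × M ≡ 2 ^ k * o) → ∃ λ s → s * s ≡ M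
  from-2-adic (k , o , odd-o , M≡2^ko) = by-parity (parity k) (oddσ⇒square (odd⇒pos odd-o) odd-o 2∤σo)
    where
    σM≡ : σ M ≡ mersenne k * σ o
    σM≡ = trans (cong σ M≡2^ko) (proj₁ (σ-2^k·odd odd-o k))
    2∤σo : ¬ 2 ∣ σ o
    2∤σo 2∣σo = 2∤σM (subst (2 ∣_) (sym σM≡) (∣n⇒∣m*n (mersenne k) 2∣σo))
    by-parity : (∃ λ j → k ≡ 2 * j) ⊎ (∃ λ j → k ≡ suc (2 * j)) → (∃ λ s → s * s ≡ o) → ∃ λ s → s * s ≡ M
    by-parity (inj₂ (j , k≡2j+1)) _ =
      ⊥-elim (3∤σM (subst (3 ∣_) (sym σM≡) (∣m⇒∣m*n (σ o) (subst (λ e → 3 ∣ mersenne e) (sym k≡2j+1) (3∣mersenne-odd j)))))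
    by-parity (inj₁ (j , k≡2j)) (s , ss≡o) =
      2 ^ j * s , sym (trans M≡2^ko (trans (cong₂ (λ e t → 2 ^ e * t) k≡2j (sym ss≡o)) (even-power-square j s)))

square-succ-square : ∀ u r → u * u + 1 ≡ r * r → u ≡ 0
square-succ-square u r uu+1≡rr with r ≤? u
... | yes r≤u = ⊥-elim (<⇒≱ (m<m+n (u * u) (s≤s z≤n)) (≤-trans (≤-reflexive uu+1≡rr) (*-mono-≤ r≤u r≤u)))
... | no  r≰u = n≤0⇒n≡0 (≤-trans (m≤n*m u 2) (+-cancelˡ-≤ (u * u + 1) (2 * u) 0 bound))
  where
  expand : ∀ u → suc u * suc u ≡ u * u + 1 + 2 * u
  expand = solve-∀
  bound : u * u + 1 + 2 * u ≤ u * u + 1 + 0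
  bound = begin
    u * u + 1 + 2 * u   ≡⟨ sym (expand u) ⟩
    suc u * suc u       ≤⟨ *-mono-≤ (≰⇒> r≰u) (≰⇒> r≰u) ⟩
    r * r               ≡⟨ sym uu+1≡rr ⟩
    u * u + 1           ≡⟨ sym (+-identityʳ (u * u + 1)) ⟩
    u * u + 1 + 0       ∎
    where open ≤-Reasoning

theorem2 : (n : ℕ) → 1 ≤ n → σ n ≡ σ (n + 1) → 2 ∣ σ n ⊎ 3 ∣ σ n
theorem2 n 1≤n σn≡σn+1 = by-cases (2 ∣? σ n) (3 ∣? σ n)
  where
  transport : ∀ {c} → c ∣ σ (n + 1) → c ∣ σ n
  transport = subst (_ ∣_) (sym σn≡σn+1)
  consecutive-squares : (∃ λ u → u * u ≡ n) → (∃ λ r → r * r ≡ n + 1) → ⊥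
  consecutive-squares (u , uu≡n) (r , rr≡n+1) =
    <⇒≢ 1≤n (sym (trans (sym uu≡n) (cong (λ v → v * v) u≡0)))
    where
    u≡0 : u ≡ 0
    u≡0 = square-succ-square u r (trans (cong (_+ 1) uu≡n) (sym rr≡n+1))
  by-cases : Dec (2 ∣ σ n) → Dec (3 ∣ σ n) → 2 ∣ σ n ⊎ 3 ∣ σ n
  by-cases (yes 2∣σ) _         = inj₁ 2∣σ
  by-cases (no _)    (yes 3∣σ) = inj₂ 3∣σ
  by-cases (no 2∤σ)  (no 3∤σ)  = ⊥-elim (consecutive-squares
    (σ-prime-to-6⇒square 1≤n 2∤σ 3∤σ)
    (σ-prime-to-6⇒square (≤-trans 1≤n (m≤m+n n 1)) (2∤σ ∘ transport) (3∤σ ∘ transport)))
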